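{- Every pseudo double wheel 1-planar graph (even or odd) is bar 1-visible.
   Context: Let $n\ge 3$ and let $C$ be a cycle $v_1u_1v_2u_2\cdots v_nu_n$ embedded in the plane, let $x$ be a vertex outside $C$ and $y$ a vertex inside $C$; join $x$ to every $u_i$ and $y$ to every $v_i$ ($1\le i\le n$). The resulting plane graph $H$ has only quadrilateral faces; in each face of $H$ add the two diagonals as a pair of crossing edges. The resulting graph (which is an optimal 1-planar graph) is called an even pseudo double wheel 1-planar graph. A $Q_v$ splitting at a vertex $v_1$ is the following operation: choose vertices $v_2,v_3$ such that $v_1v_2$ and $v_1v_3$ are edges but $v_2v_3$ is not; split the path $v_2v_1v_3$, i.e. duplicate $v_1$ into two copies, each adjacent to $v_2$ and $v_3$, the edges at $v_1$ lying on one side of the path staying at one copy and those on the other side going to the other copy; rename one copy as $v_4$; and add the edges $v_1v_4$ and $v_2v_3$. An odd pseudo double wheel 1-planar graph is an optimal 1-planar graph obtained from an even pseudo double wheel 1-planar graph by one $Q_v$ splitting. A pseudo double wheel 1-planar graph is an even or odd one. A 1-planar graph is one that can be drawn in the plane with each edge crossed at most once; it is optimal if it has the maximum possible number $4n-8$ of edges for its number $n$ of vertices. A bar 1-visibility drawing of a graph $G$ draws each vertex as a horizontal line segment (a bar), pairwise disjoint, and each edge $(u,v)$ as a vertical line segment whose two endpoints lie on the bars of $u$ and $v$, such that the vertical segment of each edge intersects at most one bar other than the bars of its two end vertices; $G$ is bar 1-visible if it has such a drawing. -}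

module Defs where

open import Data.Nat using (ℕ; zero; suc)
open import Data.Fin using (Fin; toℕ)
open import Data.Rational using (ℚ; _<_; _≤_)
open import Data.Product using (_×_; Σ)
open import Data.Sum using (_⊎_)
open import Relation.Binary.PropositionalEquality using (_≡_; _≢_)
open import Relation.Nullary using (¬_)

-- Graphs: a vertex type with a (generating) edge relation;
-- the edge set is its symmetric closure.

Sym : {V : Set} → (V → V → Set) → V → V → Set
Sym G a b = G a b ⊎ G b a

Next : {n : ℕ} → Fin n → Fin n → Set
Next {n} i j = (suc (toℕ i) ≡ toℕ j) ⊎ ((suc (toℕ i) ≡ n) × (toℕ j ≡ 0))

-- Arc a b i : i lies on the cyclic arc a, a+1, ..., b (inclusive).
data Arc {n : ℕ} (a b : Fin n) : Fin n → Set where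
  start : Arc a b a
  step  : ∀ {i j} → Arc a b i → i ≢ b → Next i j → Arc a b j

-- Even pseudo double wheel 1-planar graph (cycle v₁u₁…vₙuₙ, x outside
-- joined to all uᵢ, y inside joined to all vᵢ, plus both diagonals of
-- every quadrilateral face).  Face y vᵢ uᵢ vᵢ₊₁ gives y–uᵢ, vᵢ–vᵢ₊₁;
-- face x uᵢ vᵢ₊₁ uᵢ₊₁ gives x–vᵢ₊₁, uᵢ–uᵢ₊₁.

data EV (n : ℕ) : Set where
  x y : EV n
  u v : Fin n → EV n

data EvenGen (n : ℕ) : EV n → EV n → Set where
  vu : ∀ i → EvenGen n (v i) (u i)
  uv : ∀ {i j} → Next i j → EvenGen n (u i) (v j)
  xu : ∀ i → EvenGen n x (u i)
  yv : ∀ i → EvenGen n y (v i)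
  xv : ∀ i → EvenGen n x (v i)
  yu : ∀ i → EvenGen n y (u i)
  vv : ∀ {i j} → Next i j → EvenGen n (v i) (v j)
  uu : ∀ {i j} → Next i j → EvenGen n (u i) (u j)

EvenPDW : (n : ℕ) → EV n → EV n → Set
EvenPDW n = Sym (EvenGen n)

-- Odd pseudo double wheel 1-planar graphs: one Q_v splitting of the
-- even one.  Vertices: the old ones plus the new copy `new`.

data OV (n : ℕ) : Set where
  old : EV n → OV n
  new : OV n

-- Splitting at x along the path u_a x u_b (a, b non-adjacent on the
-- u-cycle).  x keeps u_a..u_b (cyclic arc) and the vᵢ inside that side;
-- the copy `new` gets u_b..u_a and the remaining vᵢ; add x–new, u_a–u_b.
data OddXGen (n : ℕ) (a b : Fin n) : OV n → OV n → Set where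
  keep   : ∀ {p q} → p ≢ x → q ≢ x → EvenGen n p q → OddXGen n a b (old p) (old q)
  xu'    : ∀ {i} → Arc a b i → OddXGen n a b (old x) (old (u i))
  nu'    : ∀ {i} → Arc b a i → OddXGen n a b new (old (u i))
  xv'    : ∀ {i j} → Arc a b i → i ≢ b → Next i j → OddXGen n a b (old x) (old (v j))
  nv'    : ∀ {i j} → Arc b a i → i ≢ a → Next i j → OddXGen n a b new (old (v j))
  xn     : OddXGen n a b (old x) new
  uaub   : OddXGen n a b (old (u a)) (old (u b))

OddXPDW : (n : ℕ) (a b : Fin n) → OV n → OV n → Set
OddXPDW n a b = Sym (OddXGen n a b)

-- Splitting at y along the path v_a y v_b (a, b non-adjacent on the
-- v-cycle).  y keeps v_a..v_b and the uᵢ inside that side (face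
-- y vᵢ uᵢ vᵢ₊₁); `new` gets v_b..v_a and the other uᵢ; add y–new, v_a–v_b.
data OddYGen (n : ℕ) (a b : Fin n) : OV n → OV n → Set where
  keep   : ∀ {p q} → p ≢ y → q ≢ y → EvenGen n p q → OddYGen n a b (old p) (old q)
  yv'    : ∀ {i} → Arc a b i → OddYGen n a b (old y) (old (v i))
  nv'    : ∀ {i} → Arc b a i → OddYGen n a b new (old (v i))
  yu'    : ∀ {i} → Arc a b i → i ≢ b → OddYGen n a b (old y) (old (u i))
  nu'    : ∀ {i} → Arc b a i → i ≢ a → OddYGen n a b new (old (u i))
  yn     : OddYGen n a b (old y) new
  vavb   : OddYGen n a b (old (v a)) (old (v b))

OddYPDW : (n : ℕ) (a b : Fin n) → OV n → OV n → Set
OddYPDW n a b = Sym (OddYGen n a b)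

ValidSplit : {n : ℕ} → Fin n → Fin n → Set
ValidSplit a b = (a ≢ b) × (¬ Next a b) × (¬ Next b a)

StrictlyBetween : ℚ → ℚ → ℚ → Set
StrictlyBetween p q r = ((p < q) × (q < r)) ⊎ ((r < q) × (q < p))

Crosses : {V : Set} (hgt lft rgt : V → ℚ) (a b : V) (c : ℚ) (w : V) → Set
Crosses hgt lft rgt a b c w =
  (w ≢ a) × (w ≢ b) × (lft w ≤ c) × (c ≤ rgt w) × StrictlyBetween (hgt a) (hgt w) (hgt b)

record Bar1Drawing {V : Set} (E : V → V → Set) : Set where
  field
    -- bar of vertex w: horizontal segment [lft w, rgt w] × {hgt w}
    hgt lft rgt : V → ℚ
    bar-proper  : ∀ w → lft w < rgt w
    disjoint    : ∀ w w' → w ≢ w' →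
                  (hgt w ≢ hgt w') ⊎ ((rgt w < lft w') ⊎ (rgt w' < lft w))
    -- edge (a,b): vertical segment at abscissa col a b e between the bars
    col         : ∀ a b → E a b → ℚ
    on-a        : ∀ a b (e : E a b) → (lft a ≤ col a b e) × (col a b e ≤ rgt a)
    on-b        : ∀ a b (e : E a b) → (lft b ≤ col a b e) × (col a b e ≤ rgt b)
    one-cross   : ∀ a b (e : E a b) w w' →
                  Crosses hgt lft rgt a b (col a b e) w →
                  Crosses hgt lft rgt a b (col a b e) w' → w ≡ w'

Bar1Visible : {V : Set} (E : V → V → Set) → Set
Bar1Visible E = Bar1Drawing E

module Submission where

open import Defs
open import Data.Nat using (ℕ; zero; suc; _+_; _∸_; _≤_; _<_; _≟_; _≤?_; z≤n; s≤s)
open import Data.Nat.Properties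
open import Data.Fin using (Fin; toℕ)
open import Data.Fin.Properties using (toℕ<n; toℕ-injective)
import Data.Integer as ℤ
import Data.Integer.Properties as ℤP
open import Data.Rational as ℚ using (ℚ; mkℚ)
import Data.Nat.Coprimality as Coprime
open import Data.Product using (_×_; _,_; proj₁; proj₂)
open import Data.Sum using (_⊎_; inj₁; inj₂; swap)
open import Data.Empty using (⊥; ⊥-elim)
open import Function.Definitions using (Injective)
open import Relation.Binary.PropositionalEquality
open import Relation.Nullary using (yes; no)

-- All drawings are integral layouts: vertices get distinct integer heights,
-- the bar at height h is an interval [L h, R h] depending only on h, and an
-- edge is a vertical segment in a column lying on both of its end bars.  Such
-- a layout is a bar 1-visibility drawing once every edge has a column meeting
-- at most one bar strictly between its ends (Layout.layout-drawing).
--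
-- One family of layouts serves all cases, the staircase: the 2n vertices of
-- the cycle C occupy a chain of overlapping bars in cyclic order (a Chain,
-- read from a v- or a u-vertex of a cyclic relabelling of the indices), so
-- all edges along C and between vertices two apart on C are visible; one pole
-- is at the top and sees the whole chain past its last bar; the other pole is
-- at the bottom.  For a Q_v splitting the relabelling puts the ends of the
-- split path at chain positions 0 and P, and the bottom bar is cut at P: the
-- split pole keeps the left part, seeing the positions up to P, and its copy
-- gets the right part, seeing position 0 and the positions from P on.

ℕ→ℚ : ℕ → ℚ
ℕ→ℚ k = mkℚ (ℤ.+ k) 0 (Coprime.sym (Coprime.1-coprimeTo k))

ℕ→ℚ-mono-≤ : ∀ {a b} → a ≤ b → ℕ→ℚ a ℚ.≤ ℕ→ℚ b
ℕ→ℚ-mono-≤ {a} {b} a≤b =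
  ℚ.*≤* (subst₂ ℤ._≤_ (sym (ℤP.*-identityʳ (ℤ.+ a))) (sym (ℤP.*-identityʳ (ℤ.+ b))) (ℤ.+≤+ a≤b))

ℕ→ℚ-mono-< : ∀ {a b} → a < b → ℕ→ℚ a ℚ.< ℕ→ℚ b
ℕ→ℚ-mono-< {a} {b} a<b =
  ℚ.*<* (subst₂ ℤ._<_ (sym (ℤP.*-identityʳ (ℤ.+ a))) (sym (ℤP.*-identityʳ (ℤ.+ b))) (ℤ.+<+ a<b))

ℕ→ℚ-cancel-≤ : ∀ {a b} → ℕ→ℚ a ℚ.≤ ℕ→ℚ b → a ≤ b
ℕ→ℚ-cancel-≤ {a} {b} (ℚ.*≤* le) =
  ℤP.drop‿+≤+ (subst₂ ℤ._≤_ (ℤP.*-identityʳ (ℤ.+ a)) (ℤP.*-identityʳ (ℤ.+ b)) le)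

ℕ→ℚ-cancel-< : ∀ {a b} → ℕ→ℚ a ℚ.< ℕ→ℚ b → a < b
ℕ→ℚ-cancel-< {a} {b} (ℚ.*<* lt) =
  ℤP.drop‿+<+ (subst₂ ℤ._<_ (ℤP.*-identityʳ (ℤ.+ a)) (ℤP.*-identityʳ (ℤ.+ b)) lt)

ℕ→ℚ-injective : Injective _≡_ _≡_ ℕ→ℚ
ℕ→ℚ-injective refl = refl

module Layout (L R : ℕ → ℕ) where

  OnBar : ℕ → ℕ → Set
  OnBar h c = L h ≤ c × c ≤ R h

  record Sight (lo hi : ℕ) : Set where
    constructor sight
    field
      below        : lo < hi
      column       : ℕ
      on-lo        : OnBar lo column
      on-hi        : OnBar hi column
      blocker      : ℕ
      only-blocker : ∀ w → OnBar w column → lo < w → w < hi → w ≡ blocker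

  clear-sight : ∀ {lo hi} c → lo < hi → OnBar lo c → OnBar hi c →
                (∀ w → OnBar w c → lo < w → w < hi → ⊥) → Sight lo hi
  clear-sight c lo<hi on-lo on-hi clear =
    sight lo<hi c on-lo on-hi 0 (λ w on lo<w w<hi → ⊥-elim (clear w on lo<w w<hi))

  adjacent-sight : ∀ {h} c → OnBar h c → OnBar (suc h) c → Sight h (suc h)
  adjacent-sight c on-lo on-hi =
    clear-sight c ≤-refl on-lo on-hi (λ w _ h<w w<1+h → <-irrefl refl (<-≤-trans w<1+h h<w))

  Visible : ℕ → ℕ → Set
  Visible h h' = Sight h h' ⊎ Sight h' h

  column : ∀ {h h'} → Visible h h' → ℕ
  column (inj₁ s) = Sight.column s
  column (inj₂ s) = Sight.column s

  blocker : ∀ {h h'} → Visible h h' → ℕ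
  blocker (inj₁ s) = Sight.blocker s
  blocker (inj₂ s) = Sight.blocker s

  column-on-bars : ∀ {h h'} (vis : Visible h h') → OnBar h (column vis) × OnBar h' (column vis)
  column-on-bars (inj₁ s) = Sight.on-lo s , Sight.on-hi s
  column-on-bars (inj₂ s) = Sight.on-hi s , Sight.on-lo s

  Between : ℕ → ℕ → ℕ → Set
  Between h w h' = (h < w × w < h') ⊎ (h' < w × w < h)

  met-is-blocker : ∀ {h h' w} (vis : Visible h h') → OnBar w (column vis) → Between h w h' →
                   w ≡ blocker vis
  met-is-blocker (inj₁ s) on (inj₁ (h<w , w<h')) = Sight.only-blocker s _ on h<w w<h'
  met-is-blocker (inj₁ s) on (inj₂ (h'<w , w<h)) = ⊥-elim (<-asym (Sight.below s) (<-trans h'<w w<h))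
  met-is-blocker (inj₂ s) on (inj₁ (h<w , w<h')) = ⊥-elim (<-asym (Sight.below s) (<-trans h<w w<h'))
  met-is-blocker (inj₂ s) on (inj₂ (h'<w , w<h)) = Sight.only-blocker s _ on h'<w w<h

  symmetric-closure-visible : ∀ {V : Set} {G : V → V → Set} (height : V → ℕ) →
                              (∀ {p q} → G p q → Visible (height p) (height q)) →
                              ∀ p q → Sym G p q → Visible (height p) (height q)
  symmetric-closure-visible height vis p q (inj₁ e) = vis e
  symmetric-closure-visible height vis p q (inj₂ e) = swap (vis e)

  layout-drawing : ∀ {V : Set} (E : V → V → Set) (height : V → ℕ) →
                   Injective _≡_ _≡_ height → (∀ h → L h < R h) →
                   (∀ p q → E p q → Visible (height p) (height q)) → Bar1Drawing E
  layout-drawing {V} E height height-injective bar-proper visible = record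
    { hgt        = hgt
    ; lft        = lft
    ; rgt        = rgt
    ; bar-proper = λ w → ℕ→ℚ-mono-< (bar-proper (height w))
    ; disjoint   = λ w w' w≢w' → inj₁ (λ eq → w≢w' (height-injective (ℕ→ℚ-injective eq)))
    ; col        = λ p q e → ℕ→ℚ (column (visible p q e))
    ; on-a       = λ p q e → on-bar (proj₁ (column-on-bars (visible p q e)))
    ; on-b       = λ p q e → on-bar (proj₂ (column-on-bars (visible p q e)))
    ; one-cross  = λ p q e w w' cr cr' → height-injective
                     (trans (met (visible p q e) cr) (sym (met (visible p q e) cr')))
    }
    where
    hgt lft rgt : V → ℚ
    hgt w = ℕ→ℚ (height w)
    lft w = ℕ→ℚ (L (height w))
    rgt w = ℕ→ℚ (R (height w))

    on-bar : ∀ {h c} → OnBar h c → (ℕ→ℚ (L h) ℚ.≤ ℕ→ℚ c) × (ℕ→ℚ c ℚ.≤ ℕ→ℚ (R h))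
    on-bar (l , r) = ℕ→ℚ-mono-≤ l , ℕ→ℚ-mono-≤ r

    -- a rational crossing is an integral one, hence the edge's blocker
    met : ∀ {p q w} (vis : Visible (height p) (height q)) →
          Crosses hgt lft rgt p q (ℕ→ℚ (column vis)) w → height w ≡ blocker vis
    met vis (_ , _ , l , r , inj₁ (lo<w , w<hi)) =
      met-is-blocker vis (ℕ→ℚ-cancel-≤ l , ℕ→ℚ-cancel-≤ r)
                         (inj₁ (ℕ→ℚ-cancel-< lo<w , ℕ→ℚ-cancel-< w<hi))
    met vis (_ , _ , l , r , inj₂ (hi<w , w<lo)) =
      met-is-blocker vis (ℕ→ℚ-cancel-≤ l , ℕ→ℚ-cancel-≤ r)
                         (inj₂ (ℕ→ℚ-cancel-< hi<w , ℕ→ℚ-cancel-< w<lo))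

-- Doubling, used to interleave the two vertex classes along a chain.
double : ℕ → ℕ
double p = p + p

double-suc : ∀ p → double (suc p) ≡ 2 + double p
double-suc p = cong suc (+-suc p p)

double-mono-≤ : ∀ {p q} → p ≤ q → double p ≤ double q
double-mono-≤ p≤q = +-mono-≤ p≤q p≤q

double-mono-< : ∀ {p q} → p < q → 2 + double p ≤ double q
double-mono-< {p} {q} p<q = subst (_≤ double q) (double-suc p) (double-mono-≤ p<q)

double-injective : Injective _≡_ _≡_ double
double-injective {zero}  {zero}  _ = refl
double-injective {suc p} {suc q} e =
  cong suc (double-injective (suc-injective (suc-injective (trans (sym (double-suc p)) (trans e (double-suc q))))))

double-≢-odd : ∀ p q → double p ≢ suc (double q)
double-≢-odd zero    q       ()
double-≢-odd (suc p) zero    e = 0≢1+n (sym (suc-injective (trans (sym (double-suc p)) e)))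
double-≢-odd (suc p) (suc q) e =
  double-≢-odd p q (suc-injective (suc-injective (trans (sym (double-suc p)) (trans e (cong suc (double-suc q))))))

-- Heights: 0 (bottom), 1 (second), 2 + p for the
-- chain positions p = 0 … K, and 3 + K (top).  The chain bar 2 + p is
-- [2p + 2, 2p + 6], so it overlaps the next two chain bars; the first chain
-- bar reaches right to `far`, the last one left to 1, the top bar spans
-- everything, and the bottom and second bars split the width at 2P + 6.
module Staircase (K P : ℕ) (P≤1+K : P ≤ suc K) where

  far : ℕ
  far = 12 + double K

  far-bound : ∀ {p} → p ≤ suc K → 6 + double p < far
  far-bound {p} p≤1+K = begin-strict
    6 + double p       ≤⟨ +-monoʳ-≤ 6 (double-mono-≤ p≤1+K) ⟩
    6 + double (suc K) ≡⟨ cong (6 +_) (double-suc K) ⟩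
    8 + double K       <⟨ +-monoˡ-≤ (double K) (m≤m+n 9 3) ⟩
    far                ∎
    where open ≤-Reasoning

  -- ends of the bar at height 2 + p (p = suc K is the top)
  chainL : ℕ → ℕ
  chainL p with p ≟ K
  ... | yes _ = 1
  ... | no _ with p ≟ suc K
  ...   | yes _ = 0
  ...   | no _  = 2 + double p

  chainR : ℕ → ℕ
  chainR p with p ≟ 0
  ... | yes _ = far
  ... | no _ with p ≟ suc K
  ...   | yes _ = far
  ...   | no _  = 6 + double p

  L R : ℕ → ℕ
  L 0             = 0
  L 1             = 6 + double P
  L (suc (suc p)) = chainL p
  R 0             = 6 + double P
  R 1             = far
  R (suc (suc p)) = chainR p

  open Layout L R public

  chainL-≤ : ∀ p → chainL p ≤ 2 + double p
  chainL-≤ p with p ≟ K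
  ... | yes _ = s≤s z≤n
  ... | no _ with p ≟ suc K
  ...   | yes _ = z≤n
  ...   | no _  = ≤-refl

  chainL-inner : ∀ {p} → p ≢ K → p ≢ suc K → chainL p ≡ 2 + double p
  chainL-inner {p} p≢K p≢1+K with p ≟ K
  ... | yes p≡K = ⊥-elim (p≢K p≡K)
  ... | no _ with p ≟ suc K
  ...   | yes p≡1+K = ⊥-elim (p≢1+K p≡1+K)
  ...   | no _      = refl

  chainL-last : chainL K ≡ 1
  chainL-last with K ≟ K
  ... | yes _   = refl
  ... | no K≢K = ⊥-elim (K≢K refl)

  chainL-top : chainL (suc K) ≡ 0
  chainL-top with suc K ≟ K
  ... | yes 1+K≡K = ⊥-elim (1+n≢n 1+K≡K)
  ... | no _ with suc K ≟ suc K
  ...   | yes _     = refl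
  ...   | no 1+K≢1+K = ⊥-elim (1+K≢1+K refl)

  chainR-≥ : ∀ p → 6 + double p ≤ chainR p
  chainR-≥ p with p ≟ 0
  ... | yes refl = <⇒≤ (far-bound z≤n)
  ... | no _ with p ≟ suc K
  ...   | yes refl = <⇒≤ (far-bound ≤-refl)
  ...   | no _     = ≤-refl

  chainR-inner : ∀ {p} → p ≢ 0 → p ≢ suc K → chainR p ≡ 6 + double p
  chainR-inner {p} p≢0 p≢1+K with p ≟ 0
  ... | yes p≡0 = ⊥-elim (p≢0 p≡0)
  ... | no _ with p ≟ suc K
  ...   | yes p≡1+K = ⊥-elim (p≢1+K p≡1+K)
  ...   | no _      = refl

  bar-proper : ∀ h → L h < R h
  bar-proper 0             = s≤s z≤n
  bar-proper 1             = far-bound P≤1+K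
  bar-proper (suc (suc p)) = begin-strict
    chainL p     ≤⟨ chainL-≤ p ⟩
    2 + double p <⟨ +-monoˡ-≤ (double p) (m≤m+n 3 3) ⟩
    6 + double p ≤⟨ chainR-≥ p ⟩
    chainR p     ∎
    where open ≤-Reasoning

  on-chain : ∀ p {c} → 2 + double p ≤ c → c ≤ 6 + double p → OnBar (2 + p) c
  on-chain p l r = ≤-trans (chainL-≤ p) l , ≤-trans r (chainR-≥ p)

  left-of-inner : ∀ {p q c} → p < q → q < K → chainL q ≤ c → c ≤ 3 + double p → ⊥
  left-of-inner {p} {q} {c} p<q q<K l r = 1+n≰n (begin
    4 + double p ≤⟨ +-monoʳ-≤ 2 (double-mono-< p<q) ⟩
    2 + double q ≡⟨ sym (chainL-inner (<⇒≢ q<K) (<⇒≢ (m<n⇒m<1+n q<K))) ⟩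
    chainL q     ≤⟨ l ⟩
    c            ≤⟨ r ⟩
    3 + double p ∎)
    where open ≤-Reasoning

  right-of-inner : ∀ {p q c} → 0 < q → q < p → p ≤ suc K → 5 + double p ≤ c → c ≤ chainR q → ⊥
  right-of-inner {p} {q} {c} 0<q q<p p≤1+K l r = 1+n≰n (begin
    5 + double p ≤⟨ l ⟩
    c            ≤⟨ r ⟩
    chainR q     ≡⟨ chainR-inner (≢-sym (<⇒≢ 0<q)) (<⇒≢ (<-≤-trans q<p p≤1+K)) ⟩
    6 + double q ≤⟨ +-monoʳ-≤ 4 (double-mono-< q<p) ⟩
    4 + double p ∎)
    where open ≤-Reasoning

  chain-next : ∀ p → Sight (2 + p) (3 + p)
  chain-next p = adjacent-sight (4 + double p)
    (on-chain p (+-monoˡ-≤ (double p) (m≤m+n 2 2)) (+-monoˡ-≤ (double p) (m≤m+n 4 2)))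
    (on-chain (suc p) (≤-reflexive (cong (2 +_) (double-suc p)))
                      (≤-trans (+-monoˡ-≤ (double p) (m≤m+n 4 4))
                               (≤-reflexive (sym (cong (6 +_) (double-suc p))))))

  chain-skip : ∀ p → Sight (2 + p) (4 + p)
  chain-skip p = sight (n≤1+n _) (6 + double p)
    (on-chain p (+-monoˡ-≤ (double p) (m≤m+n 2 4)) ≤-refl)
    (on-chain (2 + p) (≤-reflexive (cong (2 +_) double-2+p))
                      (≤-trans (+-monoˡ-≤ (double p) (m≤m+n 6 4)) (≤-reflexive (sym (cong (6 +_) double-2+p)))))
    (3 + p) (λ w _ lo<w w<hi → ≤-antisym (≤-pred w<hi) lo<w)
    where
    double-2+p : double (2 + p) ≡ 4 + double p
    double-2+p = trans (double-suc (suc p)) (cong (2 +_) (double-suc p))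

  -- every chain bar sees the last one, which reaches far to the left
  chain-to-last : ∀ {p} → p < K → Sight (2 + p) (2 + K)
  chain-to-last {p} p<K = clear-sight (3 + double p) (+-monoʳ-≤ 2 p<K)
    (on-chain p (n≤1+n _) (+-monoˡ-≤ (double p) (m≤m+n 3 3)))
    (≤-trans (≤-reflexive chainL-last) (s≤s z≤n)
      , ≤-trans (+-mono-≤ (m≤m+n 3 3) (double-mono-≤ (<⇒≤ p<K))) (chainR-≥ K))
    missed
    where
    missed : ∀ w → OnBar w (3 + double p) → 2 + p < w → w < 2 + K → ⊥
    missed 1 _ (s≤s ()) _
    missed (suc (suc q)) (l , _) lo<w w<hi =
      left-of-inner (≤-pred (≤-pred lo<w)) (≤-pred (≤-pred w<hi)) l ≤-refl

  -- the first chain bar, reaching far to the right, sees every chain bar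
  chain-from-first : ∀ {p} → 0 < p → p ≤ K → Sight 2 (2 + p)
  chain-from-first {p} 0<p p≤K = clear-sight (5 + double p) (+-monoʳ-≤ 2 0<p)
    (≤-trans (chainL-≤ 0) (m≤m+n 2 _) , ≤-trans (n≤1+n _) (<⇒≤ (far-bound (m≤n⇒m≤1+n p≤K))))
    (on-chain p (+-monoˡ-≤ (double p) (m≤m+n 2 3)) (n≤1+n _))
    missed
    where
    missed : ∀ w → OnBar w (5 + double p) → 2 < w → w < 2 + p → ⊥
    missed 1 _ (s≤s ()) _
    missed (suc (suc q)) (_ , r) lo<w w<hi =
      right-of-inner (≤-pred (≤-pred lo<w)) (≤-pred (≤-pred w<hi)) (m≤n⇒m≤1+n p≤K) ≤-refl r

  -- the bottom bar sees the chain up to position P, past the first chain bar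
  bottom-to-chain : ∀ {p} → p ≤ P → p ≤ K → Sight 0 (2 + p)
  bottom-to-chain {p} p≤P p≤K = sight (s≤s z≤n) (5 + double p)
    (z≤n , ≤-trans (n≤1+n _) (+-monoʳ-≤ 6 (double-mono-≤ p≤P)))
    (on-chain p (+-monoˡ-≤ (double p) (m≤m+n 2 3)) (n≤1+n _))
    2 met
    where
    met : ∀ w → OnBar w (5 + double p) → 0 < w → w < 2 + p → w ≡ 2
    met 1 (l , _) _ _ = ⊥-elim (1+n≰n (≤-trans l (+-monoʳ-≤ 5 (double-mono-≤ p≤P))))
    met 2 _ _ _ = refl
    met (suc (suc (suc q))) (_ , r) _ w<hi =
      ⊥-elim (right-of-inner (s≤s z≤n) (≤-pred (≤-pred w<hi)) (m≤n⇒m≤1+n p≤K) ≤-refl r)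

  -- the second bar sees the first chain bar and the chain from position P
  -- on, past the first chain bar
  second-to-chain : ∀ {p} → p ≡ 0 ⊎ P ≤ p → p ≤ K → Sight 1 (2 + p)
  second-to-chain (inj₁ refl) _ = adjacent-sight (6 + double P)
    (≤-refl , <⇒≤ (far-bound P≤1+K))
    (≤-trans (chainL-≤ 0) (m≤m+n 2 _) , <⇒≤ (far-bound P≤1+K))
  second-to-chain {p} (inj₂ P≤p) p≤K = sight (s≤s (s≤s z≤n)) (6 + double p)
    (+-monoʳ-≤ 6 (double-mono-≤ P≤p) , <⇒≤ (far-bound (m≤n⇒m≤1+n p≤K)))
    (on-chain p (+-monoˡ-≤ (double p) (m≤m+n 2 4)) ≤-refl)
    2 met
    where
    met : ∀ w → OnBar w (6 + double p) → 1 < w → w < 2 + p → w ≡ 2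
    met 1 _ (s≤s ()) _
    met 2 _ _ _ = refl
    met (suc (suc (suc q))) (_ , r) _ w<hi =
      ⊥-elim (right-of-inner (s≤s z≤n) (≤-pred (≤-pred w<hi)) (m≤n⇒m≤1+n p≤K) (n≤1+n _) r)

  bottom-to-second : Sight 0 1
  bottom-to-second = adjacent-sight (6 + double P) (z≤n , ≤-refl) (≤-refl , <⇒≤ (far-bound P≤1+K))

  -- the top bar sees every chain bar past the last one
  chain-to-top : ∀ {p} → p ≤ K → Sight (2 + p) (3 + K)
  chain-to-top {p} p≤K = sight (s≤s (s≤s (s≤s p≤K))) (3 + double p)
    (on-chain p (n≤1+n _) (+-monoˡ-≤ (double p) (m≤m+n 3 3)))
    (≤-trans (≤-reflexive chainL-top) z≤n
      , ≤-trans (+-mono-≤ (m≤m+n 3 3) (double-mono-≤ (m≤n⇒m≤1+n p≤K))) (chainR-≥ (suc K)))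
    (2 + K) met
    where
    met : ∀ w → OnBar w (3 + double p) → 2 + p < w → w < 3 + K → w ≡ 2 + K
    met 1 _ (s≤s ()) _
    met (suc (suc q)) (l , _) lo<w w<hi with m≤n⇒m<n∨m≡n (≤-pred (≤-pred (≤-pred w<hi)))
    ... | inj₂ q≡K = cong (2 +_) q≡K
    ... | inj₁ q<K = ⊥-elim (left-of-inner (≤-pred (≤-pred lo<w)) q<K l ≤-refl)

-- Cyclic successor modulo m on ℕ; `Next i j` is `CycSucc n (toℕ i) (toℕ j)`.
CycSucc : ℕ → ℕ → ℕ → Set
CycSucc m r r' = (suc r ≡ r') ⊎ ((suc r ≡ m) × (r' ≡ 0))

record CyclicLabelling (n : ℕ) : Set where
  field
    label           : Fin n → ℕ
    label<n         : ∀ i → label i < n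
    label-injective : Injective _≡_ _≡_ label
    label-next      : ∀ {i j} → Next i j → CycSucc n (label i) (label j)

identity-labelling : ∀ n → CyclicLabelling n
identity-labelling n = record
  { label = toℕ ; label<n = toℕ<n ; label-injective = toℕ-injective ; label-next = λ i→j → i→j }

-- Rotating the labels so that a gets label 0: t ↦ t - a (mod n).
module Rotation {n : ℕ} (a : ℕ) (a<n : a < n) where

  rotate : ℕ → ℕ
  rotate t with a ≤? t
  ... | yes _ = t ∸ a
  ... | no _  = n ∸ a + t

  data RotateView (t : ℕ) : ℕ → Set where
    not-wrapped : a ≤ t → RotateView t (t ∸ a)
    wrapped     : t < a → RotateView t (n ∸ a + t)

  rotate-view : ∀ t → RotateView t (rotate t)
  rotate-view t with a ≤? t
  ... | yes a≤t = not-wrapped a≤t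
  ... | no a≰t  = wrapped (≰⇒> a≰t)

  rotate<n : ∀ {t} → t < n → rotate t < n
  rotate<n {t} t<n with rotate t | rotate-view t
  ... | _ | not-wrapped _ = ≤-<-trans (m∸n≤m t a) t<n
  ... | _ | wrapped t<a   = begin-strict
    n ∸ a + t <⟨ +-monoʳ-< (n ∸ a) t<a ⟩
    n ∸ a + a ≡⟨ m∸n+n≡m (<⇒≤ a<n) ⟩
    n         ∎
    where open ≤-Reasoning

  unwrapped<wrapped : ∀ {t t'} → a ≤ t → t < n → t ∸ a < n ∸ a + t'
  unwrapped<wrapped a≤t t<n = <-≤-trans (∸-monoˡ-< t<n a≤t) (m≤m+n _ _)

  rotate-injective : ∀ {t t'} → t < n → t' < n → rotate t ≡ rotate t' → t ≡ t'
  rotate-injective {t} {t'} t<n t'<n eq with rotate t | rotate-view t | rotate t' | rotate-view t'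
  ... | _ | not-wrapped a≤t | _ | not-wrapped a≤t' = ∸-cancelʳ-≡ a≤t a≤t' eq
  ... | _ | wrapped _       | _ | wrapped _        = +-cancelˡ-≡ (n ∸ a) _ _ eq
  ... | _ | not-wrapped a≤t | _ | wrapped _        = ⊥-elim (<⇒≢ (unwrapped<wrapped a≤t t<n) eq)
  ... | _ | wrapped _       | _ | not-wrapped a≤t' = ⊥-elim (<⇒≢ (unwrapped<wrapped a≤t' t'<n) (sym eq))

  rotate-start : rotate a ≡ 0
  rotate-start with rotate a | rotate-view a
  ... | _ | not-wrapped _ = n∸n≡0 a
  ... | _ | wrapped a<a   = ⊥-elim (<-irrefl refl a<a)

  rotate-next : ∀ {t t'} → CycSucc n t t' → CycSucc n (rotate t) (rotate t')
  -- step t ↦ t + 1: the rotated labels step too, wrapping exactly when t + 1 = a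
  rotate-next {t} (inj₁ refl) with rotate t | rotate-view t | rotate (suc t) | rotate-view (suc t)
  ... | _ | not-wrapped a≤t | _ | not-wrapped _ = inj₁ (sym (+-∸-assoc 1 a≤t))
  ... | _ | not-wrapped a≤t | _ | wrapped 1+t<a =
    ⊥-elim (<-irrefl refl (<-trans (≤-<-trans a≤t (n<1+n t)) 1+t<a))
  ... | _ | wrapped t<a     | _ | wrapped _     = inj₁ (sym (+-suc (n ∸ a) t))
  ... | _ | wrapped t<a     | _ | not-wrapped a≤1+t =
    inj₂ (wraps , trans (cong (suc t ∸_) a≡1+t) (n∸n≡0 (suc t)))
    where
    a≡1+t : a ≡ suc t
    a≡1+t = ≤-antisym a≤1+t t<a
    wraps : suc (n ∸ a + t) ≡ n
    wraps = begin
      suc (n ∸ a + t) ≡⟨ sym (+-suc (n ∸ a) t) ⟩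
      n ∸ a + suc t   ≡⟨ cong (n ∸ a +_) (sym a≡1+t) ⟩
      n ∸ a + a       ≡⟨ m∸n+n≡m (<⇒≤ a<n) ⟩
      n               ∎
      where open ≡-Reasoning
  -- step n - 1 ↦ 0: the rotated labels step, wrapping exactly when a = 0
  rotate-next {t} (inj₂ (1+t≡n , refl)) with rotate t | rotate-view t | rotate 0 | rotate-view 0
  ... | _ | wrapped t<a     | _ | _ =
    ⊥-elim (<-irrefl refl (<-≤-trans t<a (≤-pred (subst (a <_) (sym 1+t≡n) a<n))))
  ... | _ | not-wrapped a≤t | _ | not-wrapped a≤0 = inj₂ (wraps , 0∸n≡0 a)
    where
    wraps : suc (t ∸ a) ≡ n
    wraps = trans (cong (λ s → suc (t ∸ s)) (n≤0⇒n≡0 a≤0)) 1+t≡n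
  ... | _ | not-wrapped a≤t | _ | wrapped _ = inj₁ (begin
    suc (t ∸ a) ≡⟨ sym (+-∸-assoc 1 a≤t) ⟩
    suc t ∸ a   ≡⟨ cong (_∸ a) 1+t≡n ⟩
    n ∸ a       ≡⟨ sym (+-identityʳ (n ∸ a)) ⟩
    n ∸ a + 0   ∎)
    where open ≡-Reasoning

rotate-to : ∀ {n} → Fin n → CyclicLabelling n
rotate-to {n} a = record
  { label           = λ i → rotate (toℕ i)
  ; label<n         = λ i → rotate<n (toℕ<n i)
  ; label-injective = λ {i} {j} eq → toℕ-injective (rotate-injective (toℕ<n i) (toℕ<n j) eq)
  ; label-next      = rotate-next
  }
  where open Rotation (toℕ a) (toℕ<n a)

rotate-to-start : ∀ {n} (a : Fin n) → CyclicLabelling.label (rotate-to a) a ≡ 0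
rotate-to-start a = Rotation.rotate-start (toℕ a) (toℕ<n a)

module Arcs {n : ℕ} (ℓ : CyclicLabelling n) (a : Fin n) (label-a : CyclicLabelling.label ℓ a ≡ 0) where
  open CyclicLabelling ℓ

  arc-from-start   : ∀ {b i} → Arc a b i → label i ≤ label b
  arc-before-end   : ∀ {b i} → Arc a b i → i ≢ b → label i < label b

  arc-from-start {b} start = subst (_≤ label b) (sym label-a) z≤n
  arc-from-start {b} (step {i} arc i≢b i→j) with label-next i→j
  ... | inj₁ 1+i≡j = subst (_≤ label b) 1+i≡j (arc-before-end arc i≢b)
  ... | inj₂ (1+i≡n , _) = ⊥-elim (i≢b (label-injective
          (≤-antisym (arc-from-start arc) (≤-pred (subst (label b <_) (sym 1+i≡n) (label<n b))))))

  arc-before-end arc i≢b = ≤∧≢⇒< (arc-from-start arc) (λ eq → i≢b (label-injective eq))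

  arc-to-start : ∀ {b i} → Arc b a i → label b ≤ label i ⊎ i ≡ a
  arc-to-start start = inj₁ ≤-refl
  arc-to-start (step arc i≢a i→j) with arc-to-start arc
  ... | inj₂ i≡a = ⊥-elim (i≢a i≡a)
  ... | inj₁ b≤i with label-next i→j
  ...   | inj₁ 1+i≡j     = inj₁ (≤-trans b≤i (≤-trans (n≤1+n _) (≤-reflexive 1+i≡j)))
  ...   | inj₂ (_ , j≡0) = inj₂ (label-injective (trans j≡0 (sym label-a)))

  arc-after-start : ∀ {b i} → Arc b a i → i ≢ a → label b ≤ label i
  arc-after-start arc i≢a with arc-to-start arc
  ... | inj₁ b≤i = b≤i
  ... | inj₂ i≡a = ⊥-elim (i≢a i≡a)

-- A chain places the cycle C = v u v u … at positions 0 … K, consecutive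
-- vertices of C at cyclically consecutive positions modulo K + 1.
record Chain (n K : ℕ) : Set where
  field
    pv pu        : Fin n → ℕ
    pv≤K         : ∀ i → pv i ≤ K
    pu≤K         : ∀ i → pu i ≤ K
    pv-injective : Injective _≡_ _≡_ pv
    pu-injective : Injective _≡_ _≡_ pu
    pv≢pu        : ∀ i j → pv i ≢ pu j
    v→u          : ∀ i → CycSucc (suc K) (pv i) (pu i)
    u→v          : ∀ {i j} → Next i j → CycSucc (suc K) (pu i) (pv j)

-- Reading C from a v-vertex: v with label r at 2r, u with label r at 2r + 1.
odd-after-double : ∀ {m r r'} → CycSucc (suc m) r r' →
                   CycSucc (2 + double m) (suc (double r)) (double r')
odd-after-double {r = r} (inj₁ refl)             = inj₁ (sym (double-suc r))
odd-after-double         (inj₂ (1+r≡1+m , refl)) =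
  inj₂ (cong (λ s → 2 + double s) (suc-injective 1+r≡1+m) , refl)

v-first : ∀ {m} → CyclicLabelling (suc m) → Chain (suc m) (suc (double m))
v-first {m} ℓ = record
  { pv           = λ i → double (label i)
  ; pu           = λ i → suc (double (label i))
  ; pv≤K         = λ i → m≤n⇒m≤1+n (double-mono-≤ (≤-pred (label<n i)))
  ; pu≤K         = λ i → s≤s (double-mono-≤ (≤-pred (label<n i)))
  ; pv-injective = λ eq → label-injective (double-injective eq)
  ; pu-injective = λ eq → label-injective (double-injective (suc-injective eq))
  ; pv≢pu        = λ i j → double-≢-odd (label i) (label j)
  ; v→u          = λ i → inj₁ refl
  ; u→v          = λ i→j → odd-after-double (label-next i→j)
  }
  where open CyclicLabelling ℓ

-- Reading C from a u-vertex: u with label r at 2r, v with label r at the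
-- position before, 2r - 1 modulo 2(m + 1).
prevOdd : ℕ → ℕ → ℕ
prevOdd m zero    = suc (double m)
prevOdd m (suc r) = suc (double r)

prevOdd-≤ : ∀ {m r} → r ≤ m → prevOdd m r ≤ suc (double m)
prevOdd-≤ {r = zero}  _   = ≤-refl
prevOdd-≤ {r = suc r} r<m = s≤s (double-mono-≤ (≤-trans (n≤1+n r) r<m))

prevOdd-injective : ∀ {m r r'} → r ≤ m → r' ≤ m → prevOdd m r ≡ prevOdd m r' → r ≡ r'
prevOdd-injective {r = zero}  {zero}   _   _    _  = refl
prevOdd-injective {r = suc r} {suc r'} _   _    eq = cong suc (double-injective (suc-injective eq))
prevOdd-injective {r = zero}  {suc r'} _   r'<m eq = ⊥-elim (<-irrefl (sym (double-injective (suc-injective eq))) r'<m)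
prevOdd-injective {r = suc r} {zero}   r<m _    eq = ⊥-elim (<-irrefl (double-injective (suc-injective eq)) r<m)

double-≢-prevOdd : ∀ m r r' → double r ≢ prevOdd m r'
double-≢-prevOdd m r zero     = double-≢-odd r m
double-≢-prevOdd m r (suc r') = double-≢-odd r r'

double-after-prevOdd : ∀ m r → CycSucc (2 + double m) (prevOdd m r) (double r)
double-after-prevOdd m zero    = inj₂ (refl , refl)
double-after-prevOdd m (suc r) = inj₁ (sym (double-suc r))

prevOdd-after-double : ∀ {m r r'} → CycSucc (suc m) r r' → CycSucc (2 + double m) (double r) (prevOdd m r')
prevOdd-after-double (inj₁ refl)             = inj₁ refl
prevOdd-after-double (inj₂ (1+r≡1+m , refl)) = inj₁ (cong (λ s → suc (double s)) (suc-injective 1+r≡1+m))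

prevOdd-succ : ∀ {m r r'} → CycSucc (suc m) r r' → r < m → prevOdd m r' ≡ suc (double r)
prevOdd-succ (inj₁ refl)          _   = refl
prevOdd-succ (inj₂ (1+r≡1+m , _)) r<m = ⊥-elim (<⇒≢ r<m (suc-injective 1+r≡1+m))

prevOdd-succ-≥ : ∀ {m r r'} → CycSucc (suc m) r r' → double r ≤ prevOdd m r'
prevOdd-succ-≥ (inj₁ refl)             = n≤1+n _
prevOdd-succ-≥ (inj₂ (1+r≡1+m , refl)) =
  ≤-trans (≤-reflexive (cong double (suc-injective 1+r≡1+m))) (n≤1+n _)

u-first : ∀ {m} → CyclicLabelling (suc m) → Chain (suc m) (suc (double m))
u-first {m} ℓ = record
  { pv           = λ j → prevOdd m (label j)
  ; pu           = λ i → double (label i)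
  ; pv≤K         = λ j → prevOdd-≤ (≤-pred (label<n j))
  ; pu≤K         = λ i → m≤n⇒m≤1+n (double-mono-≤ (≤-pred (label<n i)))
  ; pv-injective = λ {i} {j} eq → label-injective (prevOdd-injective (≤-pred (label<n i)) (≤-pred (label<n j)) eq)
  ; pu-injective = λ eq → label-injective (double-injective eq)
  ; pv≢pu        = λ i j eq → double-≢-prevOdd m (label j) (label i) (sym eq)
  ; v→u          = λ i → double-after-prevOdd m (label i)
  ; u→v          = λ i→j → prevOdd-after-double (label-next i→j)
  }
  where open CyclicLabelling ℓ

-- In a staircase, every edge of C is visible: consecutive chain positions
-- see each other directly, positions two apart across the one in between,
-- and the wrap-around pairs through the long first and last chain bars.
module ChainSights {n K P : ℕ} (P≤1+K : P ≤ suc K) (2≤K : 2 ≤ K) (C : Chain n K) where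
  open Staircase K P P≤1+K
  open Chain C

  step-visible : ∀ {p q} → CycSucc (suc K) p q → Visible (2 + p) (2 + q)
  step-visible (inj₁ refl)         = inj₁ (chain-next _)
  step-visible (inj₂ (refl , refl)) = inj₂ (chain-to-last (≤-trans (s≤s z≤n) 2≤K))

  two-steps-visible : ∀ {p r q} → CycSucc (suc K) p r → CycSucc (suc K) r q → Visible (2 + p) (2 + q)
  two-steps-visible (inj₁ refl) (inj₁ refl) = inj₁ (chain-skip _)
  two-steps-visible {p} (inj₁ refl) (inj₂ (2+p≡1+K , refl)) =
    inj₂ (chain-from-first (≤-pred (subst (2 ≤_) K≡1+p 2≤K))
                           (≤-trans (n≤1+n p) (≤-reflexive (sym K≡1+p))))
    where
    K≡1+p : K ≡ suc p
    K≡1+p = sym (suc-injective 2+p≡1+K)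
  two-steps-visible (inj₂ (refl , refl)) (inj₁ refl) = inj₂ (chain-to-last 2≤K)
  two-steps-visible (inj₂ (refl , refl)) (inj₂ (1≡1+K , _)) =
    ⊥-elim (<⇒≱ 2≤K (≤-trans (≤-reflexive (sym (suc-injective 1≡1+K))) z≤n))

  v-u : ∀ i → Visible (2 + pv i) (2 + pu i)
  v-u i = step-visible (v→u i)

  u-v : ∀ {i j} → Next i j → Visible (2 + pu i) (2 + pv j)
  u-v i→j = step-visible (u→v i→j)

  v-v : ∀ {i j} → Next i j → Visible (2 + pv i) (2 + pv j)
  v-v {i} i→j = two-steps-visible (v→u i) (u→v i→j)

  u-u : ∀ {i j} → Next i j → Visible (2 + pu i) (2 + pu j)
  u-u {j = j} i→j = two-steps-visible (u→v i→j) (v→u j)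

  top-v : ∀ i → Visible (3 + K) (2 + pv i)
  top-v i = inj₂ (chain-to-top (pv≤K i))

  top-u : ∀ i → Visible (3 + K) (2 + pu i)
  top-u i = inj₂ (chain-to-top (pu≤K i))

OffChain : ℕ → ℕ → Set
OffChain K h = h < 2 ⊎ 2 + K < h

off-chain : ∀ {K h p} → OffChain K h → p ≤ K → h ≢ 2 + p
off-chain (inj₁ (s≤s (s≤s ()))) _ refl
off-chain (inj₂ K<p) p≤K refl = <⇒≱ (≤-pred (≤-pred K<p)) p≤K

module PoleHeights {n K : ℕ} (C : Chain n K) (hx hy : ℕ)
                   (hx≢hy : hx ≢ hy) (hx-off : OffChain K hx) (hy-off : OffChain K hy) where
  open Chain C

  height : EV n → ℕ
  height x     = hx
  height y     = hy
  height (v i) = 2 + pv i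
  height (u i) = 2 + pu i

  height-injective : Injective _≡_ _≡_ height
  height-injective {x}   {x}   _  = refl
  height-injective {y}   {y}   _  = refl
  height-injective {x}   {y}   eq = ⊥-elim (hx≢hy eq)
  height-injective {y}   {x}   eq = ⊥-elim (hx≢hy (sym eq))
  height-injective {x}   {v i} eq = ⊥-elim (off-chain hx-off (pv≤K i) eq)
  height-injective {v i} {x}   eq = ⊥-elim (off-chain hx-off (pv≤K i) (sym eq))
  height-injective {x}   {u i} eq = ⊥-elim (off-chain hx-off (pu≤K i) eq)
  height-injective {u i} {x}   eq = ⊥-elim (off-chain hx-off (pu≤K i) (sym eq))
  height-injective {y}   {v i} eq = ⊥-elim (off-chain hy-off (pv≤K i) eq)
  height-injective {v i} {y}   eq = ⊥-elim (off-chain hy-off (pv≤K i) (sym eq))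
  height-injective {y}   {u i} eq = ⊥-elim (off-chain hy-off (pu≤K i) eq)
  height-injective {u i} {y}   eq = ⊥-elim (off-chain hy-off (pu≤K i) (sym eq))
  height-injective {v i} {v j} eq = cong v (pv-injective (suc-injective (suc-injective eq)))
  height-injective {u i} {u j} eq = cong u (pu-injective (suc-injective (suc-injective eq)))
  height-injective {v i} {u j} eq = ⊥-elim (pv≢pu i j (suc-injective (suc-injective eq)))
  height-injective {u i} {v j} eq = ⊥-elim (pv≢pu j i (suc-injective (suc-injective (sym eq))))

  height-≢ : ∀ {h} → h < 2 → h ≢ hx → h ≢ hy → ∀ w → height w ≢ h
  height-≢ _   h≢hx _    x     eq = h≢hx (sym eq)
  height-≢ _   _    h≢hy y     eq = h≢hy (sym eq)
  height-≢ h<2 _    _    (v i) eq = off-chain (inj₁ h<2) (pv≤K i) (sym eq)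
  height-≢ h<2 _    _    (u i) eq = off-chain (inj₁ h<2) (pu≤K i) (sym eq)

with-new : ∀ {n} → (EV n → ℕ) → ℕ → OV n → ℕ
with-new height h (old w) = height w
with-new height h new     = h

with-new-injective : ∀ {n} {height : EV n → ℕ} {h : ℕ} → Injective _≡_ _≡_ height →
                     (∀ w → height w ≢ h) → Injective _≡_ _≡_ (with-new height h)
with-new-injective inj free {old w} {old w'} eq = cong old (inj eq)
with-new-injective inj free {old w} {new}    eq = ⊥-elim (free w eq)
with-new-injective inj free {new}   {old w'} eq = ⊥-elim (free w' (sym eq))
with-new-injective inj free {new}   {new}    _  = refl

-- Even pseudo double wheels (n = 3 + k): chain read from v₀ in the given
-- order, x at the bottom seeing the whole chain (P = K + 1), y at the top.
module EvenDrawing (k : ℕ) where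
  n K : ℕ
  n = 3 + k
  K = suc (double (2 + k))

  C : Chain n K
  C = v-first (identity-labelling n)

  open Staircase K (suc K) ≤-refl
  open ChainSights ≤-refl (s≤s (s≤s z≤n)) C
  open Chain C
  open PoleHeights C 0 (3 + K) (λ ()) (inj₁ (s≤s z≤n)) (inj₂ ≤-refl)

  bottom-chain : ∀ {p} → p ≤ K → Visible 0 (2 + p)
  bottom-chain p≤K = inj₁ (bottom-to-chain (m≤n⇒m≤1+n p≤K) p≤K)

  edge-visible : ∀ {p q} → EvenGen n p q → Visible (height p) (height q)
  edge-visible (vu i)  = v-u i
  edge-visible (uv i→j) = u-v i→j
  edge-visible (vv i→j) = v-v i→j
  edge-visible (uu i→j) = u-u i→j
  edge-visible (xu i)  = bottom-chain (pu≤K i)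
  edge-visible (xv i)  = bottom-chain (pv≤K i)
  edge-visible (yu i)  = top-u i
  edge-visible (yv i)  = top-v i

  drawing : Bar1Visible (EvenPDW n)
  drawing = layout-drawing (EvenPDW n) height height-injective bar-proper
                           (symmetric-closure-visible height edge-visible)

-- Label the indices from a, so that
-- the split path joins chain positions 0 and P = 2 · label b.  The split
-- pole sits at the bottom and keeps the chain positions up to P, its copy
-- `new` sits at height 1 and gets position 0 and the positions from P on,
-- and the other pole is at the top.
module OddDrawings (k : ℕ) (a b : Fin (3 + k)) (a≢b : a ≢ b) where
  n m K : ℕ
  n = 3 + k
  m = 2 + k
  K = suc (double m)

  ℓ : CyclicLabelling n
  ℓ = rotate-to a
  open CyclicLabelling ℓ

  label-a : label a ≡ 0
  label-a = rotate-to-start a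

  open Arcs ℓ a label-a

  P : ℕ
  P = double (label b)

  P≤K : P ≤ K
  P≤K = m≤n⇒m≤1+n (double-mono-≤ (≤-pred (label<n b)))

  0<P : 0 < P
  0<P = ≤-trans (s≤s z≤n) (double-mono-< (≤∧≢⇒< z≤n (λ 0≡b → a≢b (label-injective (trans label-a 0≡b)))))

  open Staircase K P (m≤n⇒m≤1+n P≤K)

  split-path-visible : Visible (2 + double (label a)) (2 + P)
  split-path-visible =
    subst (λ r → Visible (2 + double r) (2 + P)) (sym label-a) (inj₁ (chain-from-first 0<P P≤K))

  moved : ∀ {i} → Arc b a i → double (label i) ≡ 0 ⊎ P ≤ double (label i)
  moved arc with arc-to-start arc
  ... | inj₁ b≤i  = inj₂ (double-mono-≤ b≤i)
  ... | inj₂ refl = inj₁ (cong double label-a)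

  -- splitting y: the chain starts with v_a
  module SplitY where
    C : Chain n K
    C = v-first ℓ
    open Chain C
    open ChainSights (m≤n⇒m≤1+n P≤K) (s≤s (s≤s z≤n)) C
    open PoleHeights C (3 + K) 0 (λ ()) (inj₂ ≤-refl) (inj₁ (s≤s z≤n))

    kept : ∀ {p q} → p ≢ y → EvenGen n p q → Visible (height p) (height q)
    kept _   (vu i)   = v-u i
    kept _   (uv i→j) = u-v i→j
    kept _   (vv i→j) = v-v i→j
    kept _   (uu i→j) = u-u i→j
    kept _   (xu i)   = top-u i
    kept _   (xv i)   = top-v i
    kept p≢y (yu i)   = ⊥-elim (p≢y refl)
    kept p≢y (yv i)   = ⊥-elim (p≢y refl)

    edge-visible : ∀ {p q} → OddYGen n a b p q → Visible (with-new height 1 p) (with-new height 1 q)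
    edge-visible (keep p≢y _ e) = kept p≢y e
    edge-visible (yv' arc)      = inj₁ (bottom-to-chain (double-mono-≤ (arc-from-start arc)) (pv≤K _))
    edge-visible (nv' arc)      = inj₁ (second-to-chain (moved arc) (pv≤K _))
    edge-visible (yu' arc i≢b)  = inj₁ (bottom-to-chain (<⇒≤ (double-mono-< (arc-before-end arc i≢b))) (pu≤K _))
    edge-visible (nu' arc i≢a)  =
      inj₁ (second-to-chain (inj₂ (m≤n⇒m≤1+n (double-mono-≤ (arc-after-start arc i≢a)))) (pu≤K _))
    edge-visible yn             = inj₁ bottom-to-second
    edge-visible vavb           = split-path-visible

    drawing : Bar1Visible (OddYPDW n a b)
    drawing = layout-drawing (OddYPDW n a b) (with-new height 1)
      (with-new-injective height-injective (height-≢ (s≤s (s≤s z≤n)) (λ ()) (λ ())))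
      bar-proper (symmetric-closure-visible (with-new height 1) edge-visible)

  -- splitting x: the chain starts with u_a
  module SplitX where
    C : Chain n K
    C = u-first ℓ
    open Chain C
    open ChainSights (m≤n⇒m≤1+n P≤K) (s≤s (s≤s z≤n)) C
    open PoleHeights C 0 (3 + K) (λ ()) (inj₁ (s≤s z≤n)) (inj₂ ≤-refl)

    kept : ∀ {p q} → p ≢ x → EvenGen n p q → Visible (height p) (height q)
    kept _   (vu i)   = v-u i
    kept _   (uv i→j) = u-v i→j
    kept _   (vv i→j) = v-v i→j
    kept _   (uu i→j) = u-u i→j
    kept _   (yu i)   = top-u i
    kept _   (yv i)   = top-v i
    kept p≢x (xu i)   = ⊥-elim (p≢x refl)
    kept p≢x (xv i)   = ⊥-elim (p≢x refl)

    kept-odd : ∀ {i j} → Arc a b i → i ≢ b → Next i j → pv j ≤ P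
    kept-odd arc i≢b i→j = begin
      prevOdd m (label _)     ≡⟨ prevOdd-succ (label-next i→j) (<-≤-trans i<b (≤-pred (label<n b))) ⟩
      suc (double (label _))  ≤⟨ <⇒≤ (double-mono-< i<b) ⟩
      P                       ∎
      where
      open ≤-Reasoning
      i<b = arc-before-end arc i≢b

    moved-odd : ∀ {i j} → Arc b a i → i ≢ a → Next i j → P ≤ pv j
    moved-odd arc i≢a i→j = ≤-trans (double-mono-≤ (arc-after-start arc i≢a)) (prevOdd-succ-≥ (label-next i→j))

    edge-visible : ∀ {p q} → OddXGen n a b p q → Visible (with-new height 1 p) (with-new height 1 q)
    edge-visible (keep p≢x _ e)    = kept p≢x e
    edge-visible (xu' arc)         = inj₁ (bottom-to-chain (double-mono-≤ (arc-from-start arc)) (pu≤K _))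
    edge-visible (nu' arc)         = inj₁ (second-to-chain (moved arc) (pu≤K _))
    edge-visible (xv' arc i≢b i→j) = inj₁ (bottom-to-chain (kept-odd arc i≢b i→j) (pv≤K _))
    edge-visible (nv' arc i≢a i→j) = inj₁ (second-to-chain (inj₂ (moved-odd arc i≢a i→j)) (pv≤K _))
    edge-visible xn                = inj₁ bottom-to-second
    edge-visible uaub              = split-path-visible

    drawing : Bar1Visible (OddXPDW n a b)
    drawing = layout-drawing (OddXPDW n a b) (with-new height 1)
      (with-new-injective height-injective (height-≢ (s≤s (s≤s z≤n)) (λ ()) (λ ())))
      bar-proper (symmetric-closure-visible (with-new height 1) edge-visible)

theorem6 : (∀ (n : ℕ) → 3 ≤ n → Bar1Visible (EvenPDW n))
           × (∀ (n : ℕ) → 3 ≤ n → (a b : Fin n) → ValidSplit a b →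
                Bar1Visible (OddXPDW n a b) × Bar1Visible (OddYPDW n a b))
theorem6 = even , odd
  where
  even : ∀ (n : ℕ) → 3 ≤ n → Bar1Visible (EvenPDW n)
  even (suc (suc (suc k))) (s≤s (s≤s (s≤s _))) = EvenDrawing.drawing k

  odd : ∀ (n : ℕ) → 3 ≤ n → (a b : Fin n) → ValidSplit a b →
        Bar1Visible (OddXPDW n a b) × Bar1Visible (OddYPDW n a b)
  odd (suc (suc (suc k))) (s≤s (s≤s (s≤s _))) a b (a≢b , _) =
    OddDrawings.SplitX.drawing k a b a≢b , OddDrawings.SplitY.drawing k a b a≢b
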